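{- Let $A,B,C,D,E$ be $\alpha$-formulae, let $\Pi_{A\otimes(B\to C)\otimes D}$ be an $\alpha$-formula obtained by permuting the prime factors of $A\otimes(B\to C)\otimes D$, and let $f\colon \Pi_{A\otimes(B\to C)\otimes D}\vdash E$ be a proper term, where no propositional letter occurs both in $A$ or $B$ and in $C$, $D$ or $E$. Then there exist terms $g\colon A\vdash B$ and $h\colon C\otimes D\vdash E$.
   Context: Formulae are built from an infinite set of propositional letters and a constant $I$ using binary connectives $\otimes$ and $\to$. An $\alpha$-formula is a formula considered up to strict associativity of $\otimes$ and strict unitality of $I$ ($A\otimes(B\otimes C)=(A\otimes B)\otimes C$, $A\otimes I=I\otimes A=A$, also inside subformulae). An $\alpha$-formula is prime if it is not of the form $A\otimes B$ with $A,B$ both different from $I$; every $\alpha$-formula is uniquely $A_1\otimes\dots\otimes A_n$ with $A_i$ prime (its prime factors). A formula is constant if it contains no letters; it is proper if it has no subformula $B\to C$ with $C$ constant and $B$ not constant. A term $f\colon A\vdash B$ is proper if $A$ and $B$ are proper. Terms with types $f\colon A\vdash B$: primitive terms $\mathbf 1_A\colon A\vdash A$, $c_{B,A}\colon B\otimes A\vdash A\otimes B$, $\eta_{A,B}\colon B\vdash A\to(A\otimes B)$, $\varepsilon_{A,B}\colon A\otimes(A\to B)\vdash B$; if $f\colon A\vdash B$ and $g\colon B\vdash C$ are terms then $g\circ f\colon A\vdash C$ is a term; if $f_i\colon A_i\vdash B_i$ are terms then $f_1\otimes f_2\colon A_1\otimes A_2\vdash B_1\otimes B_2$ is a term; if $f\colon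 B_1\vdash B_2$ is a term and $A$ an $\alpha$-formula then $A\to f\colon A\to B_1\vdash A\to B_2$ is a term. -}

module Defs where

open import Data.Nat using (ℕ)
open import Data.Bool using (Bool; true; false; _∧_; _∨_; not; T)
open import Data.Product using (_×_)
open import Data.List using (List; []; _∷_; _++_; [_])

-- α-formulae in canonical form: an α-formula is the list of its prime
-- factors (⊗ = _++_, I = []); a prime is a letter or an implication.
-- This representation realises strict associativity and unitality of ⊗/I,
-- also inside subformulae.
mutual
  data Prime : Set where
    var : ℕ → Prime
    imp : List Prime → List Prime → Prime

  Fm : Set
  Fm = List Prime

I : Fm
I = []

_⊗_ : Fm → Fm → Fm
A ⊗ B = A ++ B

_⇒_ : Fm → Fm → Fm
A ⇒ B = [ imp A B ]

infixr 6 _⊗_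
infixr 5 _⇒_

mutual
  data OccP (n : ℕ) : Prime → Set where
    here  : OccP n (var n)
    impl  : ∀ {A B} → OccF n A → OccP n (imp A B)
    impr  : ∀ {A B} → OccF n B → OccP n (imp A B)

  data OccF (n : ℕ) : Fm → Set where
    hd : ∀ {p ps} → OccP n p → OccF n (p ∷ ps)
    tl : ∀ {p ps} → OccF n ps → OccF n (p ∷ ps)

mutual
  constP : Prime → Bool
  constP (var _) = false
  constP (imp A B) = constF A ∧ constF B

  constF : Fm → Bool
  constF [] = true
  constF (p ∷ ps) = constP p ∧ constF ps

mutual
  properP : Prime → Bool
  properP (var _) = true
  properP (imp A B) = properF A ∧ properF B ∧ (not (constF B) ∨ constF A)

  properF : Fm → Bool
  properF [] = true
  properF (p ∷ ps) = properP p ∧ properF ps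

Proper : Fm → Set
Proper A = T (properF A)

data _⊢_ : Fm → Fm → Set where
  𝟏   : (A : Fm) → A ⊢ A
  c   : (B A : Fm) → (B ⊗ A) ⊢ (A ⊗ B)
  η   : (A B : Fm) → B ⊢ (A ⇒ (A ⊗ B))
  ε   : (A B : Fm) → (A ⊗ (A ⇒ B)) ⊢ B
  _∘_ : ∀ {A B C} → B ⊢ C → A ⊢ B → A ⊢ C
  _⊗ₜ_ : ∀ {A₁ A₂ B₁ B₂} → A₁ ⊢ B₁ → A₂ ⊢ B₂ → (A₁ ⊗ A₂) ⊢ (B₁ ⊗ B₂)
  _⇒ₜ_ : ∀ {B₁ B₂} → (A : Fm) → B₁ ⊢ B₂ → (A ⇒ B₁) ⊢ (A ⇒ B₂)

infix 4 _⊢_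

ProperTerm : ∀ {A B} → A ⊢ B → Set
ProperTerm {A} {B} _ = Proper A × Proper B

module Submission where

open import Defs
open import Data.Nat using (ℕ; suc; _+_; _≤_; s≤s; _≟_)
open import Data.Nat.Properties using (≤-refl; ≤-trans; m≤m+n; m≤n+m; +-assoc)
open import Data.Sum using (_⊎_; inj₁; inj₂; [_,_]′)
open import Data.Product using (_×_; _,_; proj₁; proj₂; Σ-syntax)
open import Data.Empty using (⊥-elim)
open import Data.Bool using (T; true; not; _∧_; _∨_)
open import Data.Bool.Properties using (T-∧; T-∨)
open import Function.Bundles using (Equivalence)
open import Data.List using (List; []; _∷_; _++_; [_])
open import Data.List.Properties using (++-assoc; ++-identityʳ)
open import Data.List.Relation.Unary.All as All using (All; []; _∷_)
open import Data.List.Relation.Unary.All.Properties using (++⁺; ++⁻; ++⁻ˡ; ++⁻ʳ)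
open import Data.List.Relation.Unary.Any using (here; there)
open import Data.List.Membership.Propositional using (_∈_)
open import Data.List.Membership.Propositional.Properties using (∈-∃++; ∈-++⁻)
open import Data.List.Relation.Binary.Permutation.Propositional
  using (_↭_; prep; swap; ↭-refl; ↭-sym; ↭-trans; ↭-reflexive)
import Data.List.Relation.Binary.Permutation.Propositional as ↭
open import Data.List.Relation.Binary.Permutation.Propositional.Properties
  using (All-resp-↭; ∈-resp-↭; ++-comm; ++⁺ˡ; ++⁺ʳ; shift; shifts; drop-∷; ↭-singleton-inv; ¬x∷xs↭[])
open import Relation.Binary.PropositionalEquality using (_≡_; refl; sym; cong; cong₂; subst; subst₂; module ≡-Reasoning)
open import Relation.Nullary using (¬_; Dec; yes; no)
open import Relation.Nullary.Decidable using (map′; ¬?; _⊎-dec_)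
open import Relation.Unary using (Pred; Decidable)

-- Terms are replaced by cut-free sequent derivations.  In a cut-free
-- derivation of a constant from proper formulae the antecedent is constant as
-- well: properness forbids a letter from hiding in the antecedent of an
-- implication with constant consequent.  With this, a derivation of a constant
-- from (B → K) ⊗ Γ, with K constant and Γ proper, is traced back to a
-- derivation of B from Γ.  Substituting I for letters then gives both halves:
-- erasing the letters outside A and B makes C, D, E constant and yields A ⊢ B;
-- erasing the letters of A and B makes A and B constant, and C ⊗ D derives
-- A ⊗ (B → C) ⊗ D.

module _ {a} {A : Set a} where

  ∈⇒↭∷ : ∀ {x : A} {xs} → x ∈ xs → Σ[ ys ∈ List A ] xs ↭ x ∷ ys
  ∈⇒↭∷ {x} x∈xs with ∈-∃++ x∈xs
  ... | ys , zs , refl = ys ++ zs , shift x ys zs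

  ∷↭∷-inv : ∀ {x y : A} {xs ys} → x ∷ xs ↭ y ∷ ys →
            (x ≡ y × xs ↭ ys) ⊎ Σ[ zs ∈ List A ] (xs ↭ y ∷ zs × ys ↭ x ∷ zs)
  ∷↭∷-inv {x} {y} p with ∈-resp-↭ (↭-sym p) (here refl)
  ... | here refl = inj₁ (refl , drop-∷ p)
  ... | there y∈xs with ∈⇒↭∷ y∈xs
  ...   | zs , q = inj₂ (zs , q , drop-∷ (↭-trans (↭-sym p) (↭-trans (prep x q) (swap x y ↭-refl))))

  ++↭∷-inv : ∀ {y : A} xs₁ xs₂ {ys} → xs₁ ++ xs₂ ↭ y ∷ ys →
             Σ[ zs ∈ List A ] (xs₁ ↭ y ∷ zs × ys ↭ zs ++ xs₂)
           ⊎ Σ[ zs ∈ List A ] (xs₂ ↭ y ∷ zs × ys ↭ xs₁ ++ zs)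
  ++↭∷-inv {y} xs₁ xs₂ p with ∈-++⁻ xs₁ (∈-resp-↭ (↭-sym p) (here refl))
  ... | inj₁ y∈xs₁ with ∈⇒↭∷ y∈xs₁
  ...   | zs , q = inj₁ (zs , q , drop-∷ (↭-trans (↭-sym p) (++⁺ʳ xs₂ q)))
  ++↭∷-inv {y} xs₁ xs₂ p | inj₂ y∈xs₂ with ∈⇒↭∷ y∈xs₂
  ...   | zs , q = inj₂ (zs , q , drop-∷ (↭-trans (↭-sym p) (↭-trans (++⁺ˡ xs₁ q) (shift y xs₁ zs))))

  ↭-assoc : ∀ (xs ys zs : List A) → (xs ++ ys) ++ zs ↭ xs ++ ys ++ zs
  ↭-assoc xs ys zs = ↭-reflexive (++-assoc xs ys zs)

  All-↭-++⁻ : ∀ {p} {P : Pred A p} {xs} ys {zs} → xs ↭ ys ++ zs → All P xs → All P ys × All P zs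
  All-↭-++⁻ ys p Pxs = ++⁻ ys (All-resp-↭ p Pxs)

Constant : Fm → Set
Constant = All λ P → T (constP P)

ProperFactors : Fm → Set
ProperFactors = All λ P → T (properP P)

T-∧⁻ : ∀ {x y} → T (x ∧ y) → T x × T y
T-∧⁻ = Equivalence.to T-∧

T-∧⁺ : ∀ {x y} → T x → T y → T (x ∧ y)
T-∧⁺ tx ty = Equivalence.from T-∧ (tx , ty)

T-constF⇒Constant : ∀ L → T (constF L) → Constant L
T-constF⇒Constant []      _ = []
T-constF⇒Constant (P ∷ L) t with T-∧⁻ {constP P} t
... | cP , cL = cP ∷ T-constF⇒Constant L cL

Constant⇒T-constF : ∀ {L} → Constant L → T (constF L)
Constant⇒T-constF []       = _
Constant⇒T-constF (cP ∷ cL) = T-∧⁺ cP (Constant⇒T-constF cL)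

Proper⇒ProperFactors : ∀ L → Proper L → ProperFactors L
Proper⇒ProperFactors []      _ = []
Proper⇒ProperFactors (P ∷ L) t with T-∧⁻ {properP P} t
... | pP , pL = pP ∷ Proper⇒ProperFactors L pL

constant-imp⁻ : ∀ {X Y} → T (constP (imp X Y)) → Constant X × Constant Y
constant-imp⁻ {X} {Y} t with T-∧⁻ {constF X} t
... | cX , cY = T-constF⇒Constant X cX , T-constF⇒Constant Y cY

constant-imp⁺ : ∀ {X Y} → Constant X → Constant Y → Constant (X ⇒ Y)
constant-imp⁺ cX cY = T-∧⁺ (Constant⇒T-constF cX) (Constant⇒T-constF cY) ∷ []

T-implication : ∀ {x y} → T (not x ∨ y) → T x → T y
T-implication {true} ty _ = ty

proper-imp⁻ : ∀ {X Y} → T (properP (imp X Y)) →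
              ProperFactors X × ProperFactors Y × (Constant Y → Constant X)
proper-imp⁻ {X} {Y} t with T-∧⁻ {properF X} t
... | pX , t′ with T-∧⁻ {properF Y} t′
...   | pY , cY⇒cX =
  Proper⇒ProperFactors X pX , Proper⇒ProperFactors Y pY ,
  λ cY → T-constF⇒Constant X (T-implication cY⇒cX (Constant⇒T-constF cY))

mutual
  constP⇒properP : ∀ P → T (constP P) → T (properP P)
  constP⇒properP (imp X Y) t with T-∧⁻ {constF X} t
  ... | cX , cY =
    T-∧⁺ (constF⇒properF X cX) (T-∧⁺ (constF⇒properF Y cY) (Equivalence.from T-∨ (inj₂ cX)))

  constF⇒properF : ∀ L → T (constF L) → T (properF L)
  constF⇒properF []      _ = _
  constF⇒properF (P ∷ L) t with T-∧⁻ {constP P} t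
  ... | cP , cL = T-∧⁺ (constP⇒properP P cP) (constF⇒properF L cL)

Constant⇒ProperFactors : ∀ {L} → Constant L → ProperFactors L
Constant⇒ProperFactors = All.map λ {P} → constP⇒properP P

-- The cut-free sequent calculus: antecedents are taken up to permutation
-- (rule ex), and the rule for I on the left is invisible because I = [].
infix 4 _⊩_
data _⊩_ : Fm → Fm → Set where
  ax : ∀ n → [ var n ] ⊩ [ var n ]
  ex : ∀ {Γ Γ′ E} → Γ ↭ Γ′ → Γ ⊩ E → Γ′ ⊩ E
  IR : [] ⊩ []
  ⊗R : ∀ {Γ Δ X Y} → Γ ⊩ X → Δ ⊩ Y → Γ ++ Δ ⊩ X ++ Y
  ⇒R : ∀ {Γ X Y} → Γ ++ X ⊩ Y → Γ ⊩ X ⇒ Y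
  ⇒L : ∀ {Γ Δ X Y Z} → Γ ⊩ X → Y ++ Δ ⊩ Z → imp X Y ∷ Γ ++ Δ ⊩ Z

⊩-++-identityʳ : ∀ {Γ E} → Γ ⊩ E → Γ ++ [] ⊩ E
⊩-++-identityʳ {Γ} = ex (↭-reflexive (sym (++-identityʳ Γ)))

mutual
  ⊩-reflP : ∀ P → [ P ] ⊩ [ P ]
  ⊩-reflP (var n)   = ax n
  ⊩-reflP (imp X Y) =
    ⇒R (ex (prep _ (↭-reflexive (++-identityʳ X))) (⇒L (⊩-refl X) (⊩-++-identityʳ (⊩-refl Y))))

  ⊩-refl : ∀ L → L ⊩ L
  ⊩-refl []      = IR
  ⊩-refl (P ∷ L) = ⊗R (⊩-reflP P) (⊩-refl L)

mutual
  constantP-in : ∀ P → T (constP P) → [] ⊩ [ P ]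
  constantP-in (imp X Y) t with constant-imp⁻ {X} {Y} t
  ... | cX , cY = ⇒R (ex (↭-reflexive (++-identityʳ X)) (⊗R (constant-out cX) (constant-in cY)))

  constantP-out : ∀ P → T (constP P) → [ P ] ⊩ []
  constantP-out (imp X Y) t with constant-imp⁻ {X} {Y} t
  ... | cX , cY = ⇒L (constant-in cX) (subst (_⊩ []) (sym (++-identityʳ Y)) (constant-out cY))

  constant-in : ∀ {K} → Constant K → [] ⊩ K
  constant-in []       = IR
  constant-in (cP ∷ cL) = ⊗R (constantP-in _ cP) (constant-in cL)

  constant-out : ∀ {K} → Constant K → K ⊩ []
  constant-out []       = IR
  constant-out (cP ∷ cL) = ⊗R (constantP-out _ cP) (constant-out cL)

weakenˡ : ∀ {Γ K E} → Constant K → Γ ⊩ E → K ++ Γ ⊩ E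
weakenˡ cK d = ⊗R (constant-out cK) d

weakenʳ : ∀ {Γ K E} → Constant K → Γ ⊩ E → Γ ++ K ⊩ E
weakenʳ {Γ} {K} {E} cK d = subst (Γ ++ K ⊩_) (++-identityʳ E) (⊗R d (constant-out cK))

≡⇒⊢ : ∀ {A B} → A ≡ B → A ⊢ B
≡⇒⊢ {A} refl = 𝟏 A

↭⇒⊢ : ∀ {A B} → A ↭ B → A ⊢ B
↭⇒⊢ ↭.refl          = 𝟏 _
↭⇒⊢ (↭.prep x p)    = 𝟏 [ x ] ⊗ₜ ↭⇒⊢ p
↭⇒⊢ (↭.swap x y p)  = c [ x ] [ y ] ⊗ₜ ↭⇒⊢ p
↭⇒⊢ (↭.trans p q)   = ↭⇒⊢ q ∘ ↭⇒⊢ p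

curry : ∀ {Γ X Y} → Γ ++ X ⊢ Y → Γ ⊢ X ⇒ Y
curry {Γ} {X} f = (X ⇒ₜ (f ∘ ↭⇒⊢ (++-comm X Γ))) ∘ η X Γ

apply : ∀ {Γ Δ X Y Z} → Γ ⊢ X → Y ++ Δ ⊢ Z → imp X Y ∷ Γ ++ Δ ⊢ Z
apply {Γ} {Δ} {X} {Y} g h = h ∘ (((ε X Y ∘ (g ⊗ₜ 𝟏 [ imp X Y ])) ⊗ₜ 𝟏 Δ) ∘ ↭⇒⊢ rearrange)
  where
  rearrange : imp X Y ∷ Γ ++ Δ ↭ (Γ ++ [ imp X Y ]) ++ Δ
  rearrange = ↭-trans (↭-sym (shift (imp X Y) Γ Δ)) (↭-sym (↭-assoc Γ [ imp X Y ] Δ))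

⊩⇒⊢ : ∀ {Γ E} → Γ ⊩ E → Γ ⊢ E
⊩⇒⊢ (ax n)   = 𝟏 _
⊩⇒⊢ (ex p d) = ⊩⇒⊢ d ∘ ↭⇒⊢ (↭-sym p)
⊩⇒⊢ IR       = 𝟏 []
⊩⇒⊢ (⊗R d e) = ⊩⇒⊢ d ⊗ₜ ⊩⇒⊢ e
⊩⇒⊢ (⇒R d)   = curry (⊩⇒⊢ d)
⊩⇒⊢ (⇒L d e) = apply (⊩⇒⊢ d) (⊩⇒⊢ e)

-- Cut elimination, by induction on the size of the cut formula and then on
-- the left derivation (cut-≤) or the right one (cut-⇒).

mutual
  sizeP : Prime → ℕ
  sizeP (var _)   = 1
  sizeP (imp X Y) = suc (sizeF X + sizeF Y)

  sizeF : Fm → ℕ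
  sizeF []      = 0
  sizeF (P ∷ L) = sizeP P + sizeF L

sizeF-++ : ∀ X Y → sizeF (X ++ Y) ≡ sizeF X + sizeF Y
sizeF-++ []      Y = refl
sizeF-++ (P ∷ X) Y rewrite sizeF-++ X Y = sym (+-assoc (sizeP P) (sizeF X) (sizeF Y))

mutual
  cut-≤ : ∀ n {Γ A Θ Δ C} → sizeF A ≤ n → Γ ⊩ A → Θ ⊩ C → Θ ↭ A ++ Δ → Γ ++ Δ ⊩ C
  cut-≤ n s (ax k)   e p = ex p e
  cut-≤ n s (ex q d) e p = ex (++⁺ʳ _ q) (cut-≤ n s d e p)
  cut-≤ n s IR       e p = ex p e
  cut-≤ n {Δ = Δ} s (⊗R {Γ₁} {Γ₂} {X} {Y} d₁ d₂) e p =
    ex (↭-sym (↭-assoc Γ₁ Γ₂ Δ))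
       (cut-≤ n sX d₁ (cut-≤ n sY d₂ e (↭-trans p (↭-trans (↭-assoc X Y Δ) (shifts X Y))))
                      (shifts Γ₂ X))
    where
    s′ : sizeF X + sizeF Y ≤ n
    s′ = subst (_≤ n) (sizeF-++ X Y) s
    sX : sizeF X ≤ n
    sX = ≤-trans (m≤m+n (sizeF X) (sizeF Y)) s′
    sY : sizeF Y ≤ n
    sY = ≤-trans (m≤n+m (sizeF Y) (sizeF X)) s′
  cut-≤ n s (⇒R d) e p = cut-⇒ n s d e p
  cut-≤ n {Δ = Δ} s (⇒L {Γ₁} {Γ₂} {X} {Y} g h) e p =
    ex (prep _ (↭-sym (↭-assoc Γ₁ Γ₂ Δ))) (⇒L g (ex (↭-assoc Y Γ₂ Δ) (cut-≤ n s h e p)))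

  cut-⇒ : ∀ n {Γ X Y Θ Δ C} → sizeF (X ⇒ Y) ≤ n → Γ ++ X ⊩ Y → Θ ⊩ C → Θ ↭ imp X Y ∷ Δ → Γ ++ Δ ⊩ C
  cut-⇒ n s d (ax k) p with () ← ↭-singleton-inv (↭-sym p)
  cut-⇒ n s d IR     p = ⊥-elim (¬x∷xs↭[] (↭-sym p))
  cut-⇒ n s d (ex q e) p = cut-⇒ n s d e (↭-trans q p)
  cut-⇒ n {Γ} s d (⊗R {Θ₁} {Θ₂} e₁ e₂) p with ++↭∷-inv Θ₁ Θ₂ p
  ... | inj₁ (M , q , r) = ex (↭-trans (↭-assoc Γ M Θ₂) (++⁺ˡ Γ (↭-sym r))) (⊗R (cut-⇒ n s d e₁ q) e₂)
  ... | inj₂ (M , q , r) = ex (↭-trans (shifts Θ₁ Γ) (++⁺ˡ Γ (↭-sym r))) (⊗R e₁ (cut-⇒ n s d e₂ q))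
  cut-⇒ n {Γ} {Δ = Δ} s d (⇒R {X = X′} e) p =
    ⇒R (ex (↭-sym (↭-assoc Γ Δ X′)) (cut-⇒ n s d e (++⁺ʳ X′ p)))
  cut-⇒ n {Γ} s d (⇒L {Θ₁} {Θ₂} {X′} {Y′} g h) p with ∷↭∷-inv p
  ... | inj₁ (refl , r) = cut-principal n s d g h r
  ... | inj₂ (M , q , r) with ++↭∷-inv Θ₁ Θ₂ q
  ...   | inj₁ (M₁ , q₁ , r₁) =
    ex (↭-trans (prep _ (↭-assoc Γ M₁ Θ₂)) (↭-trans (↭-sym (shift (imp X′ Y′) Γ (M₁ ++ Θ₂)))
         (++⁺ˡ Γ (↭-trans (prep _ (↭-sym r₁)) (↭-sym r)))))
       (⇒L (cut-⇒ n s d g q₁) h)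
  ...   | inj₂ (M₂ , q₂ , r₂) =
    ex (↭-trans (prep _ (shifts Θ₁ Γ)) (↭-trans (↭-sym (shift (imp X′ Y′) Γ (Θ₁ ++ M₂)))
         (++⁺ˡ Γ (↭-trans (prep _ (↭-sym r₂)) (↭-sym r)))))
       (⇒L g (ex (shifts Γ Y′) (cut-⇒ n s d h (↭-trans (++⁺ˡ Y′ q₂) (shift _ Y′ M₂)))))

  cut-principal : ∀ n {Γ X Y Θ₁ Θ₂ Δ C} → sizeF (X ⇒ Y) ≤ n →
                  Γ ++ X ⊩ Y → Θ₁ ⊩ X → Y ++ Θ₂ ⊩ C → Θ₁ ++ Θ₂ ↭ Δ → Γ ++ Δ ⊩ C
  cut-principal (suc n) {Γ} {X} {Y} {Θ₁} {Θ₂} (s≤s s) d g h r =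
    ex (↭-trans (++⁺ʳ Θ₂ (++-comm Θ₁ Γ)) (↭-trans (↭-assoc Γ Θ₁ Θ₂) (++⁺ˡ Γ r)))
       (cut-≤ n sY (cut-≤ n sX g d (++-comm Γ X)) h ↭-refl)
    where
    sXY : sizeF X + sizeF Y ≤ n
    sXY = ≤-trans (m≤m+n (sizeF X + sizeF Y) 0) s
    sX : sizeF X ≤ n
    sX = ≤-trans (m≤m+n (sizeF X) (sizeF Y)) sXY
    sY : sizeF Y ≤ n
    sY = ≤-trans (m≤n+m (sizeF Y) (sizeF X)) sXY

cut : ∀ {Γ A Θ Δ C} → Γ ⊩ A → Θ ⊩ C → Θ ↭ A ++ Δ → Γ ++ Δ ⊩ C
cut {A = A} = cut-≤ (sizeF A) ≤-refl

strengthenʳ : ∀ {Γ K E} → Constant K → Γ ++ K ⊩ E → Γ ⊩ E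
strengthenʳ {Γ} {K} cK d = cut (constant-in cK) d (++-comm Γ K)

⊢⇒⊩ : ∀ {A B} → A ⊢ B → A ⊩ B
⊢⇒⊩ (𝟏 A)    = ⊩-refl A
⊢⇒⊩ (c B A)  = ex (++-comm A B) (⊩-refl (A ++ B))
⊢⇒⊩ (η A B)  = ⇒R (ex (++-comm A B) (⊩-refl (A ++ B)))
⊢⇒⊩ (ε A B)  =
  ex (↭-trans (prep _ (↭-reflexive (++-identityʳ A))) (++-comm [ imp A B ] A))
     (⇒L (⊩-refl A) (⊩-++-identityʳ (⊩-refl B)))
⊢⇒⊩ (g ∘ f)  =
  subst (_⊩ _) (++-identityʳ _) (cut (⊢⇒⊩ f) (⊢⇒⊩ g) (↭-reflexive (sym (++-identityʳ _))))
⊢⇒⊩ (f ⊗ₜ g) = ⊗R (⊢⇒⊩ f) (⊢⇒⊩ g)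
⊢⇒⊩ (A ⇒ₜ f) =
  ⇒R (ex (prep _ (↭-reflexive (++-identityʳ A))) (⇒L (⊩-refl A) (⊩-++-identityʳ (⊢⇒⊩ f))))

constant-antecedent : ∀ {Θ E} → Θ ⊩ E → ProperFactors Θ → Constant E → Constant Θ
constant-antecedent (ax k)   _  (() ∷ _)
constant-antecedent (ex q d) pΘ cE =
  All-resp-↭ q (constant-antecedent d (All-resp-↭ (↭-sym q) pΘ) cE)
constant-antecedent IR       _  _  = []
constant-antecedent (⊗R {Θ₁} {Θ₂} {X} d₁ d₂) pΘ cE =
  ++⁺ (constant-antecedent d₁ (++⁻ˡ Θ₁ pΘ) (++⁻ˡ X cE))
      (constant-antecedent d₂ (++⁻ʳ Θ₁ pΘ) (++⁻ʳ X cE))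
constant-antecedent (⇒R {Θ} {X} {Y} d) pΘ (cI ∷ []) with constant-imp⁻ {X} {Y} cI
... | cX , cY = ++⁻ˡ Θ (constant-antecedent d (++⁺ pΘ (Constant⇒ProperFactors cX)) cY)
constant-antecedent (⇒L {Θ₁} {Θ₂} {X} {Y} g h) (pI ∷ pΘ) cE with proper-imp⁻ {X} {Y} pI
... | _ , pY , cY⇒cX with ++⁻ Y (constant-antecedent h (++⁺ pY (++⁻ʳ Θ₁ pΘ)) cE)
...   | cY , cΘ₂ = ++⁺ (constant-imp⁺ cX cY) (++⁺ (constant-antecedent g (++⁻ˡ Θ₁ pΘ) cX) cΘ₂)
  where cX = cY⇒cX cY

⇒-constant-inversion : ∀ {Θ E Γ B K} → Θ ⊩ E → Θ ↭ imp B K ∷ Γ →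
                       ProperFactors Γ → Constant K → Constant E → Γ ⊩ B
⇒-constant-inversion (ax k) p _ _ _ with () ← ↭-singleton-inv (↭-sym p)
⇒-constant-inversion IR     p _ _ _ = ⊥-elim (¬x∷xs↭[] (↭-sym p))
⇒-constant-inversion (ex q d) p pΓ cK cE = ⇒-constant-inversion d (↭-trans q p) pΓ cK cE
⇒-constant-inversion (⊗R {Θ₁} {Θ₂} {X} d₁ d₂) p pΓ cK cE with ++↭∷-inv Θ₁ Θ₂ p
... | inj₁ (M , q , r) =
  let pM , pΘ₂ = All-↭-++⁻ M r pΓ
  in ex (↭-sym r) (weakenʳ (constant-antecedent d₂ pΘ₂ (++⁻ʳ X cE))
                           (⇒-constant-inversion d₁ q pM cK (++⁻ˡ X cE)))
... | inj₂ (M , q , r) =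
  let pΘ₁ , pM = All-↭-++⁻ Θ₁ r pΓ
  in ex (↭-sym r) (weakenˡ (constant-antecedent d₁ pΘ₁ (++⁻ˡ X cE))
                           (⇒-constant-inversion d₂ q pM cK (++⁻ʳ X cE)))
⇒-constant-inversion (⇒R {X = X} {Y} d) p pΓ cK (cI ∷ []) =
  let cX , cY = constant-imp⁻ {X} {Y} cI
  in strengthenʳ cX (⇒-constant-inversion d (++⁺ʳ X p) (++⁺ pΓ (Constant⇒ProperFactors cX)) cK cY)
⇒-constant-inversion {K = K} (⇒L {Θ₁} {Θ₂} {X} {Y} g h) p pΓ cK cE with ∷↭∷-inv p
... | inj₁ (refl , r) =
  let pΘ₂ = proj₂ (All-↭-++⁻ Θ₁ (↭-sym r) pΓ)
  in ex r (weakenʳ (++⁻ʳ K (constant-antecedent h (++⁺ (Constant⇒ProperFactors cK) pΘ₂) cE)) g)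
... | inj₂ (M , q , r) with All-resp-↭ r pΓ | ++↭∷-inv Θ₁ Θ₂ q
...   | pI ∷ pM | inj₁ (M₁ , q₁ , r₁) =
  let _ , pY , cY⇒cX = proper-imp⁻ {X} {Y} pI
      pM₁ , pΘ₂ = All-↭-++⁻ M₁ r₁ pM
      cY , cΘ₂ = ++⁻ Y (constant-antecedent h (++⁺ pY pΘ₂) cE)
  in ex (↭-sym (↭-trans r (prep _ r₁)))
        (weakenˡ (constant-imp⁺ (cY⇒cX cY) cY)
                 (weakenʳ cΘ₂ (⇒-constant-inversion g q₁ pM₁ cK (cY⇒cX cY))))
...   | pI ∷ pM | inj₂ (M₂ , q₂ , r₂) =
  let _ , pY , _ = proper-imp⁻ {X} {Y} pI
      pM₂ = proj₂ (All-↭-++⁻ Θ₁ r₂ pM)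
  in ex (↭-sym (↭-trans r (prep _ r₂)))
        (⇒L g (⇒-constant-inversion h (↭-trans (++⁺ˡ Y q₂) (shift _ Y M₂)) (++⁺ pY pM₂) cK cE))

⇒-constant-inversion⊢ : ∀ {A B K L M} → A ++ imp B K ∷ L ⊢ M →
                        ProperFactors A → Constant K → Constant L → Constant M → A ⊢ B
⇒-constant-inversion⊢ {A} {B} {K} {L} f pA cK cL cM =
  ⊩⇒⊢ (strengthenʳ cL (⇒-constant-inversion (⊢⇒⊩ f) (shift (imp B K) A L)
                                             (++⁺ pA (Constant⇒ProperFactors cL)) cK cM))

discard-constants : ∀ {A B C D E} → Constant A → Constant B → A ++ imp B C ∷ D ⊢ E → C ++ D ⊢ E
discard-constants {C = C} {D} cA cB f =
  f ∘ ⊩⇒⊢ (⊗R (constant-in cA) (⊗R (⇒R (weakenʳ cB (⊩-refl C))) (⊩-refl D)))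

module _ (σ : ℕ → Fm) where

  mutual
    substP : Prime → Fm
    substP (var n)   = σ n
    substP (imp X Y) = substF X ⇒ substF Y

    substF : Fm → Fm
    substF []      = []
    substF (P ∷ L) = substP P ++ substF L

  substF-++ : ∀ X Y → substF (X ++ Y) ≡ substF X ++ substF Y
  substF-++ []      Y = refl
  substF-++ (P ∷ X) Y = begin
    substP P ++ substF (X ++ Y)          ≡⟨ cong (substP P ++_) (substF-++ X Y) ⟩
    substP P ++ substF X ++ substF Y     ≡⟨ ++-assoc (substP P) (substF X) (substF Y) ⟨
    (substP P ++ substF X) ++ substF Y   ∎
    where open ≡-Reasoning

  subst-⊢ : ∀ {A B} → A ⊢ B → substF A ⊢ substF B
  subst-⊢ (𝟏 A)    = 𝟏 (substF A)
  subst-⊢ (c B A)  = ≡⇒⊢ (sym (substF-++ A B)) ∘ (c (substF B) (substF A) ∘ ≡⇒⊢ (substF-++ B A))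
  subst-⊢ (η A B)  = (substF A ⇒ₜ ≡⇒⊢ (sym (substF-++ A B))) ∘ η (substF A) (substF B)
  subst-⊢ (ε A B)  = ε (substF A) (substF B) ∘ ≡⇒⊢ (substF-++ A [ imp A B ])
  subst-⊢ (g ∘ f)  = subst-⊢ g ∘ subst-⊢ f
  subst-⊢ (_⊗ₜ_ {A₁} {A₂} {B₁} {B₂} f g) =
    ≡⇒⊢ (sym (substF-++ B₁ B₂)) ∘ ((subst-⊢ f ⊗ₜ subst-⊢ g) ∘ ≡⇒⊢ (substF-++ A₁ A₂))
  subst-⊢ (A ⇒ₜ f) = substF A ⇒ₜ subst-⊢ f

  subst-⊢-context : ∀ {A B C D E} → A ++ imp B C ∷ D ⊢ E →
                    substF A ++ imp (substF B) (substF C) ∷ substF D ⊢ substF E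
  subst-⊢-context {A} {B} {C} {D} f = subst-⊢ f ∘ ≡⇒⊢ (sym (substF-++ A (imp B C ∷ D)))

  mutual
    substP-fixes : ∀ P → (∀ {n} → OccP n P → σ n ≡ [ var n ]) → substP P ≡ [ P ]
    substP-fixes (var n)   fixes = fixes here
    substP-fixes (imp X Y) fixes =
      cong₂ _⇒_ (substF-fixes X (λ o → fixes (impl o))) (substF-fixes Y (λ o → fixes (impr o)))

    substF-fixes : ∀ L → (∀ {n} → OccF n L → σ n ≡ [ var n ]) → substF L ≡ L
    substF-fixes []      _     = refl
    substF-fixes (P ∷ L) fixes =
      cong₂ _++_ (substP-fixes P (λ o → fixes (hd o))) (substF-fixes L (λ o → fixes (tl o)))

  mutual
    substP-constant : ∀ P → (∀ {n} → OccP n P → Constant (σ n)) → Constant (substP P)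
    substP-constant (var n)   erases = erases here
    substP-constant (imp X Y) erases =
      constant-imp⁺ (substF-constant X (λ o → erases (impl o))) (substF-constant Y (λ o → erases (impr o)))

    substF-constant : ∀ L → (∀ {n} → OccF n L → Constant (σ n)) → Constant (substF L)
    substF-constant []      _      = []
    substF-constant (P ∷ L) erases =
      ++⁺ (substP-constant P (λ o → erases (hd o))) (substF-constant L (λ o → erases (tl o)))

mutual
  occP? : ∀ n P → Dec (OccP n P)
  occP? n (var m) with n ≟ m
  ... | yes refl = yes here
  ... | no n≢m   = no λ { here → n≢m refl }
  occP? n (imp X Y) =
    map′ [ impl , impr ]′ (λ { (impl o) → inj₁ o ; (impr o) → inj₂ o }) (occF? n X ⊎-dec occF? n Y)

  occF? : ∀ n L → Dec (OccF n L)
  occF? n []      = no λ ()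
  occF? n (P ∷ L) =
    map′ [ hd , tl ]′ (λ { (hd o) → inj₁ o ; (tl o) → inj₂ o }) (occP? n P ⊎-dec occF? n L)

module _ {p} {S : Pred ℕ p} (S? : Decidable S) where

  restrict : ℕ → Fm
  restrict n with S? n
  ... | yes _ = [ var n ]
  ... | no  _ = []

  restrict-fixes : ∀ L → (∀ {n} → OccF n L → S n) → substF restrict L ≡ L
  restrict-fixes L inS = substF-fixes restrict L λ {n} o → fixes n (inS o)
    where
    fixes : ∀ n → S n → restrict n ≡ [ var n ]
    fixes n s with S? n
    ... | yes _ = refl
    ... | no ¬s = ⊥-elim (¬s s)

  restrict-erases : ∀ L → (∀ {n} → OccF n L → ¬ S n) → Constant (substF restrict L)
  restrict-erases L notS = substF-constant restrict L λ {n} o → erases n (notS o)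
    where
    erases : ∀ n → ¬ S n → Constant (restrict n)
    erases n ¬s with S? n
    ... | yes s = ⊥-elim (¬s s)
    ... | no _  = []

proposition5p3 : (A B C D E Π : Fm) → Π ↭ (A ⊗ (B ⇒ C) ⊗ D) → (f : Π ⊢ E) → ProperTerm f
    → (∀ (p : ℕ) → (OccF p A ⊎ OccF p B) → ¬ (OccF p C ⊎ OccF p D ⊎ OccF p E))
    → (A ⊢ B) × (C ⊗ D ⊢ E)
proposition5p3 A B C D E Π Π↭ f (properΠ , _) disjoint = A⊢B , C⊗D⊢E
  where
  f′ : A ++ imp B C ∷ D ⊢ E
  f′ = f ∘ ↭⇒⊢ (↭-sym Π↭)

  InAB : ℕ → Set
  InAB n = OccF n A ⊎ OccF n B

  inAB? : Decidable InAB
  inAB? n = occF? n A ⊎-dec occF? n B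

  outsideAB : ∀ {n} → OccF n C ⊎ OccF n D ⊎ OccF n E → ¬ InAB n
  outsideAB o s = disjoint _ s o

  A⊢B : A ⊢ B
  A⊢B = subst₂ _⊢_ fixA (restrict-fixes inAB? B inj₂)
          (⇒-constant-inversion⊢ (subst-⊢-context (restrict inAB?) f′) (subst ProperFactors (sym fixA) pA)
             (restrict-erases inAB? C λ o → outsideAB (inj₁ o))
             (restrict-erases inAB? D λ o → outsideAB (inj₂ (inj₁ o)))
             (restrict-erases inAB? E λ o → outsideAB (inj₂ (inj₂ o))))
    where
    fixA : substF (restrict inAB?) A ≡ A
    fixA = restrict-fixes inAB? A inj₁
    pA : ProperFactors A
    pA = proj₁ (All-↭-++⁻ A Π↭ (Proper⇒ProperFactors Π properΠ))

  C⊗D⊢E : C ⊗ D ⊢ E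
  C⊗D⊢E = subst₂ _⊢_ (cong₂ _++_ (fix C inj₁) (fix D λ o → inj₂ (inj₁ o)))
                     (fix E λ o → inj₂ (inj₂ o))
            (discard-constants (restrict-erases notAB? A λ o ¬s → ¬s (inj₁ o))
                               (restrict-erases notAB? B λ o ¬s → ¬s (inj₂ o))
                               (subst-⊢-context (restrict notAB?) f′))
    where
    notAB? : Decidable λ n → ¬ InAB n
    notAB? n = ¬? (inAB? n)
    fix : ∀ L → (∀ {n} → OccF n L → OccF n C ⊎ OccF n D ⊎ OccF n E) →
          substF (restrict notAB?) L ≡ L
    fix L inCDE = restrict-fixes notAB? L λ o → outsideAB (inCDE o)
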